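{- If a symmetric $0,1$-matrix $M$ admits a sequence of symmetric $k$-diagonal divisions, then $\mathrm{stw}(M)\leq 4k^3$.
   Context: Let $M$ be a symmetric $n\times n$ $0,1$-matrix with rows $r_1,\dots,r_n$ and columns $c_1,\dots,c_n$. A symmetric partition of $M$ is a pair $(\mathcal R,\mathcal C)$ with $\mathcal R$ a partition of the rows and $\mathcal C$ a partition of the columns such that $r_i,r_j$ lie in the same part iff $c_i,c_j$ do; each row part $R$ has a symmetric column part. The zone $R\cap C$ is the submatrix with rows $R$ and columns $C$; it is non-constant if it contains two distinct entries. A symmetric partition sequence of $M$ is a sequence of symmetric partitions starting with the partition into singletons, ending with one row part and one column part, each obtained from the previous one by merging two row parts and the two symmetric column parts. The span of a set of columns (rows) is the set of columns (rows) with index between its minimum and maximum index; two sets conflict if their spans intersect. The stretch value of a row part $R$ is the number of column parts conflicting with the union of all column parts $C$ such that $C$ is the symmetric of $R$ or $R\cap C$ is non-constant; symmetrically for column parts; the stretch value of a partition is the maximum over its parts. $\mathrm{stw}(M)$ is the minimum over symmetric partition sequences of the maximum stretch value of a partition in the sequence. A division is a symmetric partition whose parts consist of consecutive rows (columns), written $(R_1,\dots,R_p)$, $(C_1,\dots,C_p)$ in order. A row part $R_i$ is $k$-wide if for every $k$ consecutive column parts $C_j,\dots,C_{j+k-1}$ with $j\le i\le j+k-1$, the submatrix with rows $R_i$ and all columns outside $C_j\cup\dots\cup C_{j+k-1}$ has at least $k$ distinct rows; symmetrically for column parts. A division is $k$-diagonal if none of its row and column parts is $k$-wide. A sequence of symmetric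 $k$-diagonal divisions is a symmetric partition sequence each of whose partitions is a $k$-diagonal division. -}

module Defs where

open import Data.Bool using (Bool; true; false; _∧_; _∨_; not; _xor_)
open import Data.Nat using (ℕ; zero; suc; _+_; _*_; _^_; _≤_; _<_; _⊔_; _≤ᵇ_; _<ᵇ_; _≡ᵇ_)
open import Data.Fin using (Fin; toℕ)
open import Data.List using (List; foldr; map; length; allFin; filterᵇ)
open import Data.Bool.ListAction using (any)
open import Data.Product using (Σ; ∃; _×_; _,_)
open import Data.Sum using (_⊎_)
open import Relation.Nullary using (¬_)
open import Relation.Binary.PropositionalEquality using (_≡_; _≢_)
open import Function.Bundles using (_⇔_)

Matrix : ℕ → Set
Matrix n = Fin n → Fin n → Bool

Symmetric : ∀ {n} → Matrix n → Set
Symmetric M = ∀ i j → M i j ≡ M j i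

Subset : ℕ → Set
Subset n = Fin n → Bool

anyF : ∀ {n} → (Fin n → Bool) → Bool
anyF {n} p = any p (allFin n)

countF : ∀ {n} → (Fin n → Bool) → ℕ
countF {n} p = length (filterᵇ p (allFin n))

maxF : ∀ {n} → (Fin n → ℕ) → ℕ
maxF {n} f = foldr _⊔_ 0 (map f (allFin n))

-- Symmetric partitions, represented by a labelling of the indices:
-- r_i (and c_i) lies in the part labelled (lab i).  Row part of r_i and
-- column part of c_i are symmetric to each other.

Labeling : ℕ → Set
Labeling n = Fin n → ℕ

part : ∀ {n} → Labeling n → Fin n → Subset n
part lab i j = lab j ≡ᵇ lab i

-- c is the smallest index of its part (used to count parts once each)
isRep : ∀ {n} → Labeling n → Fin n → Bool
isRep lab c = not (anyF (λ c′ → (toℕ c′ <ᵇ toℕ c) ∧ (lab c′ ≡ᵇ lab c)))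

inSpan : ∀ {n} → Subset n → Fin n → Bool
inSpan A x = anyF (λ a → anyF (λ b →
  A a ∧ A b ∧ (toℕ a ≤ᵇ toℕ x) ∧ (toℕ x ≤ᵇ toℕ b)))

conflict : ∀ {n} → Subset n → Subset n → Bool
conflict A B = anyF (λ x → inSpan A x ∧ inSpan B x)

nonConst : ∀ {n} → Matrix n → Subset n → Subset n → Bool
nonConst M R C = anyF (λ a → anyF (λ b → anyF (λ c → anyF (λ d →
  R a ∧ C b ∧ R c ∧ C d ∧ (M a b xor M c d)))))

rowStretch : ∀ {n} → Matrix n → Labeling n → Fin n → ℕ
rowStretch M lab i =
  let U : Subset _
      U j = (lab j ≡ᵇ lab i) ∨ nonConst M (part lab i) (part lab j)
  in countF (λ c → isRep lab c ∧ conflict (part lab c) U)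

colStretch : ∀ {n} → Matrix n → Labeling n → Fin n → ℕ
colStretch M lab j =
  let V : Subset _
      V i = (lab i ≡ᵇ lab j) ∨ nonConst M (part lab i) (part lab j)
  in countF (λ r → isRep lab r ∧ conflict (part lab r) V)

stretchValue : ∀ {n} → Matrix n → Labeling n → ℕ
stretchValue M lab = maxF (λ i → rowStretch M lab i ⊔ colStretch M lab i)

Singletons : ∀ {n} → Labeling n → Set
Singletons lab = ∀ i j → lab i ≡ lab j → i ≡ j

OnePart : ∀ {n} → Labeling n → Set
OnePart lab = ∀ i j → lab i ≡ lab j

MergeStep : ∀ {n} → Labeling n → Labeling n → Set
MergeStep {n} P Q = Σ (Fin n) λ a → Σ (Fin n) λ b → P a ≢ P b ×
  (∀ i j → (Q i ≡ Q j) ⇔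
     (P i ≡ P j ⊎ (P i ≡ P a × P j ≡ P b) ⊎ (P i ≡ P b × P j ≡ P a)))

record PartitionSequence (n : ℕ) : Set where
  field
    len   : ℕ
    P     : ℕ → Labeling n
    start : Singletons (P 0)
    end   : OnePart (P len)
    step  : ∀ t → t < len → MergeStep (P t) (P (suc t))
open PartitionSequence public

stw≤ : ∀ {n} → Matrix n → ℕ → Set
stw≤ {n} M b = Σ (PartitionSequence n) λ S →
  ∀ t → t ≤ len S → stretchValue M (P S t) ≤ b

Division : ∀ {n} → Labeling n → Set
Division lab = ∀ i j x → toℕ i ≤ toℕ x → toℕ x ≤ toℕ j →
  lab i ≡ lab j → lab x ≡ lab i

-- 1-based position of the part containing x (meaningful for divisions)
partIdx : ∀ {n} → Labeling n → Fin n → ℕ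
partIdx lab x = countF (λ r → isRep lab r ∧ (toℕ r ≤ᵇ toℕ x))

-- Index y lies in the window of k consecutive parts C_j … C_{j+k-1}
-- with j = partIdx i − s (s < k), i.e. j ≤ idx y ≤ j+k-1;
-- parts with indices outside 1…p are simply absent.
InWindow : ∀ {n} → Labeling n → ℕ → Fin n → ℕ → Fin n → Set
InWindow lab k i s y =
  partIdx lab i ≤ partIdx lab y + s × partIdx lab y + s < partIdx lab i + k

RowWide : ∀ {n} → Matrix n → Labeling n → ℕ → Fin n → Set
RowWide {n} M lab k i = ∀ s → s < k →
  Σ (Fin k → Fin n) λ f → (∀ x → lab (f x) ≡ lab i) ×
    (∀ x y → x ≢ y → Σ (Fin n) λ c → ¬ InWindow lab k i s c × M (f x) c ≢ M (f y) c)

ColWide : ∀ {n} → Matrix n → Labeling n → ℕ → Fin n → Set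
ColWide {n} M lab k j = ∀ s → s < k →
  Σ (Fin k → Fin n) λ f → (∀ x → lab (f x) ≡ lab j) ×
    (∀ x y → x ≢ y → Σ (Fin n) λ r → ¬ InWindow lab k j s r × M r (f x) ≢ M r (f y))

Diagonal : ∀ {n} → Matrix n → ℕ → Labeling n → Set
Diagonal M k lab = Division lab ×
  (∀ i → ¬ RowWide M lab k i × ¬ ColWide M lab k i)

HasDiagonalSequence : ∀ {n} → Matrix n → ℕ → Set
HasDiagonalSequence {n} M k = Σ (PartitionSequence n) λ S →
  ∀ t → t ≤ len S → Diagonal M k (P S t)

{-# OPTIONS --safe #-}
-- Fix a division D and call rows x and y twins if they lie in the same part of D and agree
-- on every column whose part is at distance at least k from the part of x.  As D is not
-- k-wide, each part of D splits into fewer than k twin classes.  Along the given sequence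
-- D₀, …, D_L the twin partitions coarsen from singletons (D₀) to a single part (D_L), and
-- consecutive ones are joined by merging one twin class of D_t at a time.  Each partition Q
-- met on the way lies between the twin partitions of D_t and D_{t+1}, so a non-constant zone
-- or a conflict of Q can only involve parts at distance less than k in D_{t+1}.  The parts
-- of Q conflicting with a given one therefore come from at most 2k consecutive parts of
-- D_{t+1}, each covered by at most three parts of D_t with fewer than k twin classes each,
-- and 2k · 3(k − 1) ≤ 4k³.
module Submission where

open import Data.Bool using (Bool; true; false; T; not; _∧_; _∨_; _xor_; if_then_else_)
open import Data.Bool.Properties using (T-∧; T-∨; T?) renaming (_≟_ to _≟ᵇ_)
open import Data.Empty using (⊥-elim)
open import Data.Fin using (Fin; toℕ) renaming (zero to fzero; suc to fsuc)
open import Data.Fin.Properties using (toℕ-injective; toℕ<n; all?; any?; ¬∀⟶∃¬)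
import Data.Fin.Properties as Fin
open import Data.List using (foldr; map; length; allFin; filterᵇ; tabulate)
open import Data.List.Membership.Propositional using (lose)
open import Data.List.Membership.Propositional.Properties using (∈-allFin)
open import Data.List.Relation.Unary.Any using (satisfied)
open import Data.List.Relation.Unary.Any.Properties using (any⁺; any⁻)
open import Data.Nat
open import Data.Nat.Properties
open import Data.Nat.Tactic.RingSolver using (solve-∀)
open import Algebra.Properties.CommutativeSemigroup +-commutativeSemigroup using (interchange; xy∙z≈zy∙x)
open import Data.Product using (Σ; ∃; _×_; _,_; proj₁; proj₂)
open import Data.Sum using (_⊎_; inj₁; inj₂; [_,_])
import Data.Sum as Sum
import Data.Product as Product
open import Data.Unit using (tt)
open import Function using (_∘_; id)
open import Function.Definitions using (Injective)
open import Function.Bundles using (_⇔_; mk⇔; Equivalence)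
open import Relation.Binary.PropositionalEquality hiding ([_])
open import Relation.Binary.Definitions using (tri<; tri≈; tri>)
open import Relation.Nullary using (¬_; Dec; yes; no; ¬?; _×-dec_; _→-dec_)
open import Relation.Nullary.Decidable using (isYes; toWitness; fromWitness; decidable-stable)

open import Defs

open Equivalence using (to; from)

T-not⁺ : ∀ {b} → ¬ T b → T (not b)
T-not⁺ {false} _ = tt
T-not⁺ {true} ¬b = ¬b tt

T-not⁻ : ∀ {b} → T (not b) → ¬ T b
T-not⁻ {false} _ ()

T-xor⇒≢ : ∀ {a b} → T (a xor b) → a ≢ b
T-xor⇒≢ {true} {false} _ ()
T-xor⇒≢ {false} {true} _ ()

anyF⇒ : ∀ {n} (p : Fin n → Bool) → T (anyF p) → ∃ λ x → T (p x)
anyF⇒ {n} p h = satisfied (any⁻ p (allFin n) h)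

⇒anyF : ∀ {n} (p : Fin n → Bool) x → T (p x) → T (anyF p)
⇒anyF p x px = any⁺ p (lose (∈-allFin x) px)

maxF-lub : ∀ {n} (f : Fin n → ℕ) {b} → (∀ x → f x ≤ b) → maxF f ≤ b
maxF-lub {n} f = go (λ x → x)
  where
  go : ∀ {m} (g : Fin m → Fin n) {b} → (∀ x → f (g x) ≤ b) →
       foldr _⊔_ 0 (map f (tabulate g)) ≤ b
  go {m = zero} g bound = z≤n
  go {m = suc m} g bound = ⊔-lub (bound fzero) (go (g ∘ fsuc) (bound ∘ fsuc))

indicator : Bool → ℕ
indicator b = if b then 1 else 0

count : ∀ {n} → (Fin n → Bool) → ℕ
count {zero}  p = 0
count {suc n} p = indicator (p fzero) + count (p ∘ fsuc)

countF≡count : ∀ {n} (p : Fin n → Bool) → countF p ≡ count p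
countF≡count {n} p = go (λ x → x)
  where
  go : ∀ {m} (g : Fin m → Fin n) → length (filterᵇ p (tabulate g)) ≡ count (p ∘ g)
  go {zero} g = refl
  go {suc m} g with p (g fzero)
  ... | true  = cong suc (go (g ∘ fsuc))
  ... | false = go (g ∘ fsuc)

indicator-mono : ∀ {a b} → (T a → T b) → indicator a ≤ indicator b
indicator-mono {false} _ = z≤n
indicator-mono {true} {true} _ = ≤-refl
indicator-mono {true} {false} a⇒b = ⊥-elim (a⇒b tt)

count-mono : ∀ {n} (p q : Fin n → Bool) → (∀ x → T (p x) → T (q x)) → count p ≤ count q
count-mono {zero} _ _ _ = z≤n
count-mono {suc n} p q p⇒q =
  +-mono-≤ (indicator-mono (p⇒q fzero)) (count-mono (p ∘ fsuc) (q ∘ fsuc) (p⇒q ∘ fsuc))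

count-strict : ∀ {n} (p q : Fin n → Bool) → (∀ x → T (p x) → T (q x)) →
  ∀ {r} → T (q r) → ¬ T (p r) → count p < count q
count-strict {suc n} p q p⇒q {fzero} qr ¬pr =
  +-mono-<-≤ (strict (p fzero) (q fzero) qr ¬pr) (count-mono (p ∘ fsuc) (q ∘ fsuc) (p⇒q ∘ fsuc))
  where
  strict : ∀ a b → T b → ¬ T a → indicator a < indicator b
  strict false true _ _ = ≤-refl
  strict true _ _ ¬a = ⊥-elim (¬a tt)
count-strict {suc n} p q p⇒q {fsuc r} qr ¬pr =
  +-mono-≤-< (indicator-mono (p⇒q fzero)) (count-strict (p ∘ fsuc) (q ∘ fsuc) (p⇒q ∘ fsuc) qr ¬pr)

count-none : ∀ {n} {p : Fin n → Bool} → (∀ x → ¬ T (p x)) → count p ≡ 0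
count-none {zero} _ = refl
count-none {suc n} {p} none with p fzero | none fzero
... | false | _ = count-none (none ∘ fsuc)
... | true  | ¬t = ⊥-elim (¬t tt)

count-split : ∀ {n} (p q : Fin n → Bool) →
  count p ≡ count (λ x → p x ∧ q x) + count (λ x → p x ∧ not (q x))
count-split {zero} p q = refl
count-split {suc n} p q = begin
  indicator (p fzero) + count (p ∘ fsuc)
    ≡⟨ cong₂ _+_ (split (p fzero) (q fzero)) (count-split (p ∘ fsuc) (q ∘ fsuc)) ⟩
  (indicator (p fzero ∧ q fzero) + indicator (p fzero ∧ not (q fzero))) + (count pq + count p¬q)
    ≡⟨ interchange (indicator (p fzero ∧ q fzero)) _ (count pq) _ ⟩
  (indicator (p fzero ∧ q fzero) + count pq) + (indicator (p fzero ∧ not (q fzero)) + count p¬q) ∎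
  where
  open ≡-Reasoning
  pq p¬q : Fin n → Bool
  pq x = p (fsuc x) ∧ q (fsuc x)
  p¬q x = p (fsuc x) ∧ not (q (fsuc x))
  split : ∀ a b → indicator a ≡ indicator (a ∧ b) + indicator (a ∧ not b)
  split false _ = refl
  split true true = refl
  split true false = refl

count-∨ : ∀ {n} (p q : Fin n → Bool) → count (λ x → p x ∨ q x) ≤ count p + count q
count-∨ {zero} p q = z≤n
count-∨ {suc n} p q = begin
  indicator (p fzero ∨ q fzero) + count (λ x → p (fsuc x) ∨ q (fsuc x))
    ≤⟨ +-mono-≤ (∨-bound (p fzero) (q fzero)) (count-∨ (p ∘ fsuc) (q ∘ fsuc)) ⟩
  (indicator (p fzero) + indicator (q fzero)) + (count (p ∘ fsuc) + count (q ∘ fsuc))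
    ≡⟨ interchange (indicator (p fzero)) _ (count (p ∘ fsuc)) _ ⟩
  (indicator (p fzero) + count (p ∘ fsuc)) + (indicator (q fzero) + count (q ∘ fsuc)) ∎
  where
  open ≤-Reasoning
  ∨-bound : ∀ a b → indicator (a ∨ b) ≤ indicator a + indicator b
  ∨-bound false _ = ≤-refl
  ∨-bound true _ = s≤s z≤n

choose : ∀ {n} (p : Fin n → Bool) {k} → k ≤ count p →
  Σ (Fin k → Fin n) λ f → (∀ i → T (p (f i))) × Injective _≡_ _≡_ f
choose p {zero} _ = (λ ()) , (λ ()) , λ {}
choose {suc n} p {suc k} h with p fzero in eq
... | true with choose (p ∘ fsuc) {k} (s≤s⁻¹ h)
...   | f , fp , f-inj = g , gp , g-inj
  where
  g : Fin (suc k) → Fin (suc n)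
  g fzero = fzero
  g (fsuc i) = fsuc (f i)
  gp : ∀ i → T (p (g i))
  gp fzero rewrite eq = tt
  gp (fsuc i) = fp i
  g-inj : Injective _≡_ _≡_ g
  g-inj {fzero} {fzero} _ = refl
  g-inj {fsuc i} {fsuc j} e = cong fsuc (f-inj (Fin.suc-injective e))
choose {suc n} p {suc k} h | false with choose (p ∘ fsuc) {suc k} h
... | f , fp , f-inj = fsuc ∘ f , fp , f-inj ∘ Fin.suc-injective

pigeonhole : ∀ {n} (p : Fin n → Bool) (g : Fin n → ℕ) lo w {m} →
  (∀ x → T (p x) → lo ≤ g x × g x < lo + w) →
  (∀ v → count (λ x → p x ∧ (g x ≡ᵇ v)) ≤ m) → count p ≤ w * m
pigeonhole p g lo zero range _ = ≤-reflexive (count-none empty)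
  where
  empty : ∀ x → ¬ T (p x)
  empty x px = let lo≤gx , gx<lo+0 = range x px in
    <⇒≱ gx<lo+0 (≤-trans (≤-reflexive (+-identityʳ lo)) lo≤gx)
pigeonhole p g lo (suc w) {m} range fibre = begin
  count p                           ≡⟨ count-split p (λ x → g x ≡ᵇ top) ⟩
  count (λ x → p x ∧ (g x ≡ᵇ top)) + count below ≤⟨ +-mono-≤ (fibre top) rest ⟩
  m + w * m                         ∎
  where
  open ≤-Reasoning
  top : ℕ
  top = lo + w
  below : Fin _ → Bool
  below x = p x ∧ not (g x ≡ᵇ top)
  below-range : ∀ x → T (below x) → lo ≤ g x × g x < lo + w
  below-range x bx with to T-∧ bx
  ... | px , g≢top with range x px
  ...   | lo≤gx , gx<lo+1+w with m<1+n⇒m<n∨m≡n (subst (g x <_) (+-suc lo w) gx<lo+1+w)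
  ...     | inj₁ gx<top = lo≤gx , gx<top
  ...     | inj₂ gx≡top = ⊥-elim (T-not⁻ g≢top (≡⇒≡ᵇ _ _ gx≡top))
  rest : count below ≤ w * m
  rest = pigeonhole below g lo w below-range λ v → ≤-trans (count-mono _ _ (narrow v)) (fibre v)
    where
    narrow : ∀ v x → T (below x ∧ (g x ≡ᵇ v)) → T (p x ∧ (g x ≡ᵇ v))
    narrow v x h = let bx , gv = to (T-∧ {below x}) h in from T-∧ (proj₁ (to (T-∧ {p x}) bx) , gv)

least : ∀ {n} → (Fin n → Bool) → ℕ
least {zero}  p = 0
least {suc n} p = if p fzero then 0 else suc (least (p ∘ fsuc))

least-≤ : ∀ {n} (p : Fin n → Bool) {x} → T (p x) → least p ≤ toℕ x
least-≤ {suc n} p {fzero} px with p fzero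
... | true = z≤n
least-≤ {suc n} p {fsuc x} px with p fzero
... | true  = z≤n
... | false = s≤s (least-≤ (p ∘ fsuc) px)

least-attained : ∀ {n} (p : Fin n → Bool) {x} → T (p x) → ∃ λ y → toℕ y ≡ least p × T (p y)
least-attained {suc n} p {x} px with p fzero in eq
... | true = fzero , refl , subst T (sym eq) tt
least-attained {suc n} p {fzero} px | false rewrite eq = ⊥-elim px
least-attained {suc n} p {fsuc x} px | false =
  let y , y≡least , py = least-attained (p ∘ fsuc) px in fsuc y , cong suc y≡least , py

least-minimal : ∀ {n} (p : Fin n → Bool) {y} → toℕ y < least p → ¬ T (p y)
least-minimal {suc n} p {fzero} _ with p fzero
... | false = λ ()
least-minimal {suc n} p {fsuc y} y<least with p fzero
... | false = least-minimal (p ∘ fsuc) (s≤s⁻¹ y<least)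

least-cong : ∀ {n} {p q : Fin n → Bool} → (∀ x → T (p x) ⇔ T (q x)) → least p ≡ least q
least-cong {zero} _ = refl
least-cong {suc n} {p} {q} p⇔q with p fzero | q fzero | p⇔q fzero
... | true  | true  | _ = refl
... | false | false | _ = cong suc (least-cong (p⇔q ∘ fsuc))
... | true  | false | e = ⊥-elim (to e tt)
... | false | true  | e = ⊥-elim (from e tt)

infix 4 _⊑_

_⊑_ : ∀ {n} → Labeling n → Labeling n → Set
P ⊑ Q = ∀ x y → P x ≡ P y → Q x ≡ Q y

module _ {n} (lab : Labeling n) where

  private
    earlier : Fin n → Fin n → Bool
    earlier c c′ = (toℕ c′ <ᵇ toℕ c) ∧ (lab c′ ≡ᵇ lab c)

  isRep⇒ : ∀ {c} → T (isRep lab c) → ∀ {c′} → toℕ c′ < toℕ c → lab c′ ≢ lab c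
  isRep⇒ {c} rep {c′} c′<c eq =
    T-not⁻ rep (⇒anyF (earlier c) c′ (from T-∧ (<⇒<ᵇ c′<c , ≡⇒≡ᵇ _ _ eq)))

  ⇒isRep : ∀ {c} → (∀ {c′} → toℕ c′ < toℕ c → lab c′ ≢ lab c) → T (isRep lab c)
  ⇒isRep {c} first = T-not⁺ λ h →
    let c′ , h′ = anyF⇒ (earlier c) h ; c′<c , eq = to T-∧ h′ in first (<ᵇ⇒< _ _ c′<c) (≡ᵇ⇒≡ _ _ eq)

  isRep-unique : ∀ {a b} → T (isRep lab a) → T (isRep lab b) → lab a ≡ lab b → a ≡ b
  isRep-unique {a} {b} rep-a rep-b eq with <-cmp (toℕ a) (toℕ b)
  ... | tri< a<b _ _ = ⊥-elim (isRep⇒ rep-b a<b eq)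
  ... | tri≈ _ a≡b _ = toℕ-injective a≡b
  ... | tri> _ _ b<a = ⊥-elim (isRep⇒ rep-a b<a (sym eq))

  first-of-part : ∀ y → ∃ λ r → T (isRep lab r) × lab r ≡ lab y × toℕ r ≤ toℕ y
  first-of-part y =
    let r , r≡least , in-part = least-attained member (≡⇒≡ᵇ (lab y) (lab y) refl)
        lab-r = ≡ᵇ⇒≡ _ _ in-part
    in r , ⇒isRep (λ c′<r eq → least-minimal member (subst (_ <_) r≡least c′<r)
                              (≡⇒≡ᵇ _ _ (trans eq lab-r)))
         , lab-r
         , subst (_≤ toℕ y) (sym r≡least) (least-≤ member (≡⇒≡ᵇ (lab y) (lab y) refl))
    where
    member : Fin n → Bool
    member z = lab z ≡ᵇ lab y

isRep-⊑ : ∀ {n} {P Q : Labeling n} → P ⊑ Q → ∀ {c} → T (isRep Q c) → T (isRep P c)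
isRep-⊑ {P = P} {Q} P⊑Q rep = ⇒isRep P λ c′<c eq → isRep⇒ Q rep c′<c (P⊑Q _ _ eq)

repsUpTo : ∀ {n} → Labeling n → Fin n → Fin n → Bool
repsUpTo lab x r = isRep lab r ∧ (toℕ r ≤ᵇ toℕ x)

rank : ∀ {n} → Labeling n → Fin n → ℕ
rank lab x = count (repsUpTo lab x)

partIdx≡rank : ∀ {n} (lab : Labeling n) x → partIdx lab x ≡ rank lab x
partIdx≡rank lab x = countF≡count (repsUpTo lab x)

module _ {n} (lab : Labeling n) where

  private
    repsUpTo-mono : ∀ {x y} → toℕ x ≤ toℕ y → ∀ r → T (repsUpTo lab x r) → T (repsUpTo lab y r)
    repsUpTo-mono x≤y r h = let rep , r≤x = to (T-∧ {isRep lab r}) h in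
      from (T-∧ {isRep lab r}) (rep , ≤⇒≤ᵇ {toℕ r} (≤-trans (≤ᵇ⇒≤ _ _ r≤x) x≤y))

  rank-mono : ∀ {x y} → toℕ x ≤ toℕ y → rank lab x ≤ rank lab y
  rank-mono {x} {y} x≤y = count-mono (repsUpTo lab x) (repsUpTo lab y) (repsUpTo-mono x≤y)

  private
    rank-cong-≤ : Division lab → ∀ {x y} → toℕ x ≤ toℕ y → lab x ≡ lab y → rank lab x ≡ rank lab y
    rank-cong-≤ div {x} {y} x≤y eq = ≤-antisym (rank-mono x≤y) (count-mono (repsUpTo lab y) (repsUpTo lab x) shrink)
      where
      shrink : ∀ r → T (repsUpTo lab y r) → T (repsUpTo lab x r)
      shrink r h with to (T-∧ {isRep lab r}) h
      ... | rep , r≤y with toℕ r ≤? toℕ x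
      ...   | yes r≤x = from (T-∧ {isRep lab r}) (rep , ≤⇒≤ᵇ {toℕ r} r≤x)
      ...   | no r≰x =
        ⊥-elim (isRep⇒ lab rep (≰⇒> r≰x) (sym (div x y r (<⇒≤ (≰⇒> r≰x)) (≤ᵇ⇒≤ _ _ r≤y) eq)))

  rank-cong : Division lab → ∀ {x y} → lab x ≡ lab y → rank lab x ≡ rank lab y
  rank-cong div {x} {y} eq with ≤-total (toℕ x) (toℕ y)
  ... | inj₁ x≤y = rank-cong-≤ div x≤y eq
  ... | inj₂ y≤x = sym (rank-cong-≤ div y≤x (sym eq))

  rank-strict : Division lab → ∀ {x y} → lab x ≢ lab y → toℕ x < toℕ y → rank lab x < rank lab y
  rank-strict div {x} {y} x≉y x<y with first-of-part lab y
  ... | r , rep , lab-r , r≤y =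
    count-strict (repsUpTo lab x) (repsUpTo lab y) (repsUpTo-mono (<⇒≤ x<y))
      (from (T-∧ {isRep lab r}) (rep , ≤⇒≤ᵇ {toℕ r} r≤y)) r∉upTo-x
    where
    r∉upTo-x : ¬ T (repsUpTo lab x r)
    r∉upTo-x h =
      x≉y (trans (div r y x (≤ᵇ⇒≤ _ _ (proj₂ (to (T-∧ {isRep lab r}) h))) (<⇒≤ x<y) lab-r) lab-r)

  rank-injective : Division lab → ∀ {x y} → rank lab x ≡ rank lab y → lab x ≡ lab y
  rank-injective div {x} {y} eq with lab x ≟ lab y
  ... | yes same = same
  ... | no differ with <-cmp (toℕ x) (toℕ y)
  ...   | tri< x<y _ _ = ⊥-elim (<-irrefl eq (rank-strict div differ x<y))
  ...   | tri≈ _ x≡y _ = ⊥-elim (differ (cong lab (toℕ-injective x≡y)))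
  ...   | tri> _ _ y<x = ⊥-elim (<-irrefl (sym eq) (rank-strict div (differ ∘ sym) y<x))

  rank-split : ∀ {x y} → toℕ y ≤ toℕ x →
    rank lab x ≡ rank lab y + count (λ r → repsUpTo lab x r ∧ not (toℕ r ≤ᵇ toℕ y))
  rank-split {x} {y} y≤x = trans (count-split (repsUpTo lab x) (λ r → toℕ r ≤ᵇ toℕ y))
    (cong (_+ count (λ r → repsUpTo lab x r ∧ not (toℕ r ≤ᵇ toℕ y)))
          (≤-antisym (count-mono _ (repsUpTo lab y) narrow) (count-mono (repsUpTo lab y) _ widen)))
    where
    narrow : ∀ r → T (repsUpTo lab x r ∧ (toℕ r ≤ᵇ toℕ y)) → T (repsUpTo lab y r)
    narrow r h = let u , r≤y = to (T-∧ {repsUpTo lab x r}) h in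
      from (T-∧ {isRep lab r}) (proj₁ (to (T-∧ {isRep lab r}) u) , r≤y)
    widen : ∀ r → T (repsUpTo lab y r) → T (repsUpTo lab x r ∧ (toℕ r ≤ᵇ toℕ y))
    widen r h = from (T-∧ {repsUpTo lab x r}) (repsUpTo-mono y≤x r h , proj₂ (to (T-∧ {isRep lab r}) h))

-- rank Q x ∸ rank Q y ≤ rank P x ∸ rank P y, stated without subtraction:
-- merging parts can only shrink the distance between two parts.
rank-coarsen : ∀ {n} {P Q : Labeling n} → P ⊑ Q → ∀ {x y} → toℕ y ≤ toℕ x →
  rank Q x + rank P y ≤ rank P x + rank Q y
rank-coarsen {n} {P} {Q} P⊑Q {x} {y} y≤x = begin
  rank Q x + rank P y       ≡⟨ cong (_+ rank P y) (rank-split Q y≤x) ⟩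
  rank Q y + between Q + rank P y ≤⟨ +-monoˡ-≤ (rank P y) (+-monoʳ-≤ (rank Q y) fewer) ⟩
  rank Q y + between P + rank P y ≡⟨ xy∙z≈zy∙x (rank Q y) (between P) (rank P y) ⟩
  rank P y + between P + rank Q y ≡⟨ cong (_+ rank Q y) (rank-split P y≤x) ⟨
  rank P x + rank Q y       ∎
  where
  open ≤-Reasoning
  between : Labeling n → ℕ
  between lab = count (λ r → repsUpTo lab x r ∧ not (toℕ r ≤ᵇ toℕ y))
  fewer : between Q ≤ between P
  fewer = count-mono _ _ λ r h →
    let u , r>y = to (T-∧ {repsUpTo Q x r}) h ; rep , r≤x = to (T-∧ {isRep Q r}) u in
    from (T-∧ {repsUpTo P x r}) (from (T-∧ {isRep P r}) (isRep-⊑ P⊑Q rep , r≤x) , r>y)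

record Canonical {n} (lab : Labeling n) : Set where
  field
    label≤index : ∀ x → lab x ≤ toℕ x
    label-attained : ∀ x → ∃ λ z → toℕ z ≡ lab x × lab z ≡ lab x

module Twins {n} (M : Matrix n) (k : ℕ) where

  -- x and y lie in a common window of k consecutive parts of D (cf. InWindow)
  Near : Labeling n → Fin n → Fin n → Set
  Near D x y = rank D x < rank D y + k × rank D y < rank D x + k

  near? : ∀ D x y → Dec (Near D x y)
  near? D x y = (rank D x <? rank D y + k) ×-dec (rank D y <? rank D x + k)

  Near-sym : ∀ {D x y} → Near D x y → Near D y x
  Near-sym (x<y+k , y<x+k) = y<x+k , x<y+k

  Near-rank : ∀ {D x y x′ y′} → rank D x ≡ rank D x′ → rank D y ≡ rank D y′ →
    Near D x y → Near D x′ y′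
  Near-rank {D} {x} {y} {x′} {y′} ex ey near =
    subst₂ (λ a b → a < b + k × b < a + k) ex ey near

  rank≡⇒Near : 1 ≤ k → ∀ {D x y} → rank D x ≡ rank D y → Near D x y
  rank≡⇒Near k≥1 {D} {x} {y} eq = lt eq , lt (sym eq)
    where
    lt : ∀ {a b} → a ≡ b → a < b + k
    lt {a} {b} refl = m<m+n a k≥1

  private
    transfer : ∀ {a a′ b b′} → a′ + b ≤ a + b′ → a < b + k → a′ < b′ + k
    transfer {a} {a′} {b} {b′} gap a<b+k = +-cancelʳ-< b a′ (b′ + k) (begin-strict
      a′ + b       ≤⟨ gap ⟩
      a + b′       <⟨ +-monoˡ-< b′ a<b+k ⟩
      b + k + b′   ≡⟨ xy∙z≈zy∙x b k b′ ⟩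
      b′ + k + b   ∎)
      where open ≤-Reasoning

  Near-coarsen : 1 ≤ k → ∀ {D D′} → D ⊑ D′ → ∀ {x y} → Near D x y → Near D′ x y
  Near-coarsen k≥1 {D} {D′} D⊑D′ {x} {y} (x<y+k , y<x+k) with ≤-total (toℕ y) (toℕ x)
  ... | inj₁ y≤x = transfer (rank-coarsen D⊑D′ y≤x) x<y+k , ≤-<-trans (rank-mono D′ y≤x) (m<m+n _ k≥1)
  ... | inj₂ x≤y = ≤-<-trans (rank-mono D′ x≤y) (m<m+n _ k≥1) , transfer (rank-coarsen D⊑D′ x≤y) y<x+k

  Agree : Labeling n → Fin n → Fin n → Set
  Agree D x y = ∀ c → ¬ Near D x c → M x c ≡ M y c

  Twin : Labeling n → Fin n → Fin n → Set
  Twin D x y = D x ≡ D y × Agree D x y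

  twin? : ∀ D x y → Dec (Twin D x y)
  twin? D x y = (D x ≟ D y) ×-dec all? (λ c → ¬? (near? D x c) →-dec (M x c ≟ᵇ M y c))

  -- each twin class is labelled by its least member
  classes : Labeling n → Labeling n
  classes D x = least (λ z → isYes (twin? D z x))

  twin⁺ : ∀ D x y → Twin D x y → T (isYes (twin? D x y))
  twin⁺ D x y = fromWitness

  twin⁻ : ∀ D x y → T (isYes (twin? D x y)) → Twin D x y
  twin⁻ D x y = toWitness

  module _ {D : Labeling n} (div : Division D) where

    Twin-refl : ∀ x → Twin D x x
    Twin-refl x = refl , λ _ _ → refl

    Twin-sym : ∀ {x y} → Twin D x y → Twin D y x
    Twin-sym (eq , agree) =
      sym eq , λ c far → sym (agree c (far ∘ Near-rank {D} (rank-cong D div eq) refl))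

    Twin-trans : ∀ {x y z} → Twin D x y → Twin D y z → Twin D x z
    Twin-trans (eq₁ , agree₁) (eq₂ , agree₂) =
      trans eq₁ eq₂ ,
      λ c far → trans (agree₁ c far) (agree₂ c (far ∘ Near-rank {D} (sym (rank-cong D div eq₁)) refl))

    Twin⇒classes≡ : ∀ {x y} → Twin D x y → classes D x ≡ classes D y
    Twin⇒classes≡ {x} {y} x~y = least-cong λ z → mk⇔
      (λ h → twin⁺ D z y (Twin-trans (twin⁻ D z x h) x~y))
      (λ h → twin⁺ D z x (Twin-trans (twin⁻ D z y h) (Twin-sym x~y)))

    classes-attained : ∀ x → ∃ λ z → toℕ z ≡ classes D x × Twin D z x
    classes-attained x =
      let z , z≡least , h = least-attained (λ z → isYes (twin? D z x)) (twin⁺ D x x (Twin-refl x))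
      in z , z≡least , twin⁻ D z x h

    classes≡⇒Twin : ∀ {x y} → classes D x ≡ classes D y → Twin D x y
    classes≡⇒Twin {x} {y} eq
      with classes-attained x | classes-attained y
    ... | z , z≡x , z~x | z′ , z′≡y , z′~y with toℕ-injective (trans z≡x (trans eq (sym z′≡y)))
    ...   | refl = Twin-trans (Twin-sym z~x) z′~y

    classes-canonical : Canonical (classes D)
    classes-canonical = record
      { label≤index = λ x → least-≤ (λ z → isYes (twin? D z x)) (twin⁺ D x x (Twin-refl x))
      ; label-attained = λ x → let z , z≡x , z~x = classes-attained x in z , z≡x , Twin⇒classes≡ z~x
      }

  Twin-coarsen : 1 ≤ k → ∀ {D D′} → D ⊑ D′ → ∀ {x y} → Twin D x y → Twin D′ x y
  Twin-coarsen k≥1 D⊑D′ (eq , agree) =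
    D⊑D′ _ _ eq , λ c far → agree c (far ∘ Near-coarsen k≥1 D⊑D′)

  classes-coarsen : 1 ≤ k → ∀ {D D′} → Division D → Division D′ → D ⊑ D′ → classes D ⊑ classes D′
  classes-coarsen k≥1 div div′ D⊑D′ x y eq =
    Twin⇒classes≡ div′ (Twin-coarsen k≥1 D⊑D′ (classes≡⇒Twin div eq))

  InWindow⇒Near : ∀ {D x s c} → s < k → InWindow D k x s c → Near D x c
  InWindow⇒Near {D} {x} {s} {c} s<k in-window
    rewrite partIdx≡rank D x | partIdx≡rank D c =
    let x≤c+s , c+s<x+k = in-window in
    ≤-<-trans x≤c+s (+-monoʳ-< (rank D c) s<k) , ≤-<-trans (m≤m+n (rank D c) s) c+s<x+k

  -- k pairwise non-twin rows of one part witness that the part is k-wide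
  classes-in-part<k : ∀ {D} → Division D → ∀ x → ¬ RowWide M D k x →
    count (λ c → isRep (classes D) c ∧ (D c ≡ᵇ D x)) < k
  classes-in-part<k {D} div x narrow = ≰⇒> λ k≤count → narrow (wide k≤count)
    where
    inPart : Fin n → Bool
    inPart c = isRep (classes D) c ∧ (D c ≡ᵇ D x)

    wide : k ≤ count inPart → RowWide M D k x
    wide k≤count s s<k with choose inPart k≤count
    ... | f , f-in-part , f-injective = f , same-part , separated
      where
      rep : ∀ i → T (isRep (classes D) (f i))
      rep i = proj₁ (to (T-∧ {isRep (classes D) (f i)}) (f-in-part i))
      same-part : ∀ i → D (f i) ≡ D x
      same-part i = ≡ᵇ⇒≡ _ _ (proj₂ (to (T-∧ {isRep (classes D) (f i)}) (f-in-part i)))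
      ¬agree : ∀ {i j} → i ≢ j → ¬ Agree D (f i) (f j)
      ¬agree i≢j agree = i≢j (f-injective (isRep-unique (classes D) (rep _) (rep _)
        (Twin⇒classes≡ div (trans (same-part _) (sym (same-part _)) , agree))))
      separated : ∀ i j → i ≢ j → Σ (Fin n) λ c → ¬ InWindow D k x s c × M (f i) c ≢ M (f j) c
      separated i j i≢j
        with ¬∀⟶∃¬ n _ (λ c → ¬? (near? D (f i) c) →-dec (M (f i) c ≟ᵇ M (f j) c)) (¬agree i≢j)
      ... | c , disagree =
        c , (λ w → proj₁ (split disagree) (Near-rank {D} (rank-cong D div (sym (same-part i))) refl
                                             (InWindow⇒Near {D} s<k w)))
          , proj₂ (split disagree)
        where
        split : ∀ {A B : Set} → ¬ (¬ A → B) → ¬ A × ¬ B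
        split h = (λ a → h (λ ¬a → ⊥-elim (¬a a))) , (λ b → h (λ _ → b))

inSpan⇒ : ∀ {n} (A : Subset n) x → T (inSpan A x) →
  Σ (Fin n) λ a → Σ (Fin n) λ b → T (A a) × T (A b) × toℕ a ≤ toℕ x × toℕ x ≤ toℕ b
inSpan⇒ A x h =
  let a , h₁ = anyF⇒ _ h ; b , h₂ = anyF⇒ _ h₁
      Aa , rest = to (T-∧ {A a}) h₂ ; Ab , bounds = to (T-∧ {A b}) rest
      a≤x , x≤b = to (T-∧ {toℕ a ≤ᵇ toℕ x}) bounds
  in a , b , Aa , Ab , ≤ᵇ⇒≤ _ _ a≤x , ≤ᵇ⇒≤ _ _ x≤b

conflict⇒ : ∀ {n} (A B : Subset n) → T (conflict A B) → ∃ λ x → T (inSpan A x) × T (inSpan B x)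
conflict⇒ A B h = let x , h₁ = anyF⇒ _ h in x , to (T-∧ {inSpan A x}) h₁

nonConst⇒ : ∀ {n} (M : Matrix n) (R C : Subset n) → T (nonConst M R C) →
  Σ (Fin n) λ a → Σ (Fin n) λ b → Σ (Fin n) λ c → Σ (Fin n) λ d →
  T (R a) × T (C b) × T (R c) × T (C d) × M a b ≢ M c d
nonConst⇒ M R C h =
  let a , h₁ = anyF⇒ _ h ; b , h₂ = anyF⇒ _ h₁ ; c , h₃ = anyF⇒ _ h₂ ; d , h₄ = anyF⇒ _ h₃
      Ra , h₅ = to (T-∧ {R a}) h₄ ; Cb , h₆ = to (T-∧ {C b}) h₅
      Rc , h₇ = to (T-∧ {R c}) h₆ ; Cd , differ = to (T-∧ {C d}) h₇
  in a , b , c , d , Ra , Cb , Rc , Cd , T-xor⇒≢ differ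

module Locality {n} (M : Matrix n) (k : ℕ) {D′ Q : Labeling n} (div′ : Division D′)
  (Q⊑ : Q ⊑ Twins.classes M k D′) where

  open Twins M k

  private
    twin : ∀ {x y} → Q x ≡ Q y → Twin D′ x y
    twin {x} {y} eq = classes≡⇒Twin div′ (Q⊑ x y eq)

    same-rank : ∀ {x y} → Q x ≡ Q y → rank D′ x ≡ rank D′ y
    same-rank eq = rank-cong D′ div′ (proj₁ (twin eq))

    member : ∀ {x a} → T (part Q x a) → Q a ≡ Q x
    member = ≡ᵇ⇒≡ _ _

  far-zone-constant : Symmetric M → ∀ {x y} → ¬ Near D′ x y → ∀ {a b c d} →
    T (part Q x a) → T (part Q y b) → T (part Q x c) → T (part Q y d) → M a b ≡ M c d
  far-zone-constant symM {x} {y} far {a} {b} {c} {d} a∈x b∈y c∈x d∈y = begin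
    M a b ≡⟨ proj₂ (twin (trans (member a∈x) (sym (member c∈x)))) b (far ∘ ranks a∈x b∈y) ⟩
    M c b ≡⟨ symM c b ⟩
    M b c ≡⟨ proj₂ (twin (trans (member b∈y) (sym (member d∈y)))) c (far ∘ Near-sym {D′} ∘ ranks b∈y c∈x) ⟩
    M d c ≡⟨ symM d c ⟩
    M c d ∎
    where
    open ≡-Reasoning
    ranks : ∀ {x y u v} → T (part Q x u) → T (part Q y v) → Near D′ u v → Near D′ x y
    ranks u∈x v∈y = Near-rank {D′} (same-rank (member u∈x)) (same-rank (member v∈y))

  nonConst⇒Near : Symmetric M → ∀ {x y} → T (nonConst M (part Q x) (part Q y)) → Near D′ x y
  nonConst⇒Near symM {x} {y} h with near? D′ x y | nonConst⇒ M (part Q x) (part Q y) h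
  ... | yes near | _ = near
  ... | no far | _ , _ , _ , _ , a∈x , b∈y , c∈x , d∈y , differ =
    ⊥-elim (differ (far-zone-constant symM far a∈x b∈y c∈x d∈y))

  span-in-one-part : ∀ {c a b x} → T (part Q c a) → T (part Q c b) → toℕ a ≤ toℕ x → toℕ x ≤ toℕ b →
    rank D′ x ≡ rank D′ c
  span-in-one-part {c} {a} {b} {x} a∈c b∈c a≤x x≤b = rank-cong D′ div′
    (trans (div′ a b x a≤x x≤b (trans D′a≡D′c (sym D′b≡D′c))) D′a≡D′c)
    where
    D′a≡D′c : D′ a ≡ D′ c
    D′a≡D′c = proj₁ (twin (member a∈c))
    D′b≡D′c : D′ b ≡ D′ c
    D′b≡D′c = proj₁ (twin (member b∈c))

  conflict⇒Near : ∀ {U : Subset n} {j} → (∀ z → T (U z) → Near D′ j z) →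
    ∀ {c} → T (conflict (part Q c) U) → Near D′ j c
  conflict⇒Near {U} {j} U-near {c} h with conflict⇒ (part Q c) U h
  ... | x , x∈span-c , x∈span-U with inSpan⇒ (part Q c) x x∈span-c | inSpan⇒ U x x∈span-U
  ...   | _ , _ , a∈c , b∈c , a≤x , x≤b | a′ , b′ , a′∈U , b′∈U , a′≤x , x≤b′ =
    Near-rank {D′} refl (span-in-one-part a∈c b∈c a≤x x≤b)
      ( <-≤-trans (proj₁ (U-near a′ a′∈U)) (+-monoˡ-≤ k (rank-mono D′ a′≤x))
      , ≤-<-trans (rank-mono D′ x≤b′) (proj₂ (U-near b′ b′∈U)) )

CoveredByThreeParts : ∀ {n} → Labeling n → Labeling n → Set
CoveredByThreeParts {n} D D′ = ∀ d → Σ (Fin n) λ a → Σ (Fin n) λ b →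
  ∀ c → D′ c ≡ D′ d → D c ≡ D d ⊎ D c ≡ D a ⊎ D c ≡ D b

MergeStep⇒⊑ : ∀ {n} {D D′ : Labeling n} → MergeStep D D′ → D ⊑ D′
MergeStep⇒⊑ (_ , _ , _ , merged) x y eq = from (merged x y) (inj₁ eq)

MergeStep⇒covered : ∀ {n} {D D′ : Labeling n} → MergeStep D D′ → CoveredByThreeParts D D′
MergeStep⇒covered (a , b , _ , merged) d = a , b , λ c eq →
  Sum.map₂ (Sum.map proj₁ proj₁) (to (merged c d) eq)

covered-refl : ∀ {n} (D : Labeling n) → CoveredByThreeParts D D
covered-refl D d = d , d , λ _ eq → inj₁ eq

cubic-bound : ∀ k → (k + k) * (3 * (k ∸ 1)) ≤ 4 * k ^ 3
cubic-bound zero = z≤n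
cubic-bound (suc k) = subst ((suc k + suc k) * (3 * k) ≤_) (sym (expand k)) (m≤m+n _ _)
  where
  expand : ∀ k → 4 * (suc k * (suc k * (suc k * 1))) ≡
           (suc k + suc k) * (3 * k) + (4 * (k * k * k) + 6 * (k * k) + 6 * k + 4)
  expand = solve-∀

module StretchBound {n} (M : Matrix n) (symM : Symmetric M) (k : ℕ) (k≥1 : 1 ≤ k)
  {D D′ : Labeling n} (div : Division D) (narrow : ∀ x → ¬ RowWide M D k x)
  (div′ : Division D′) (covered : CoveredByThreeParts D D′) where

  open Twins M k

  private
    classesD : Labeling n
    classesD = classes D

    nearᵇ : Fin n → Fin n → Bool
    nearᵇ j c = isYes (near? D′ j c)

    classOf : Fin n → Fin n → Bool
    classOf z c = isRep classesD c ∧ (D c ≡ᵇ D z)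

    classes-in-part≤ : ∀ z → count (classOf z) ≤ k ∸ 1
    classes-in-part≤ z = ∸-monoˡ-≤ 1 (classes-in-part<k div z (narrow z))

    atRank : Fin n → ℕ → Fin n → Bool
    atRank j v c = (isRep classesD c ∧ nearᵇ j c) ∧ (rank D′ c ≡ᵇ v)

    atRank⇒ : ∀ {j v u} → T (atRank j v u) → T (isRep classesD u) × rank D′ u ≡ v
    atRank⇒ {j} {v} {u} h = let rep∧near , at-v = to (T-∧ {isRep classesD u ∧ nearᵇ j u}) h in
      proj₁ (to (T-∧ {isRep classesD u}) rep∧near) , ≡ᵇ⇒≡ _ _ at-v

    atRank⊆ : ∀ {j v c₀} → T (atRank j v c₀) → ∀ {a b} →
      (∀ c → D′ c ≡ D′ c₀ → D c ≡ D c₀ ⊎ D c ≡ D a ⊎ D c ≡ D b) →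
      ∀ c → T (atRank j v c) → T (classOf c₀ c ∨ (classOf a c ∨ classOf b c))
    atRank⊆ {c₀ = c₀} at₀ {a} {b} cover c at with atRank⇒ at | atRank⇒ at₀
    ... | rep , c-at-v | _ , c₀-at-v =
      to-∨ (cover c (rank-injective D′ div′ (trans c-at-v (sym c₀-at-v))))
      where
      class : ∀ {z} → D c ≡ D z → T (classOf z c)
      class eq = from (T-∧ {isRep classesD c}) (rep , ≡⇒≡ᵇ _ _ eq)
      to-∨ : D c ≡ D c₀ ⊎ D c ≡ D a ⊎ D c ≡ D b → T (classOf c₀ c ∨ (classOf a c ∨ classOf b c))
      to-∨ = from (T-∨ {classOf c₀ c}) ∘ Sum.map class (from (T-∨ {classOf a c}) ∘ Sum.map class class)

    classes-at-rank≤ : ∀ j v → count (atRank j v) ≤ 3 * (k ∸ 1)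
    classes-at-rank≤ j v with any? (λ c → T? (atRank j v c))
    ... | no none = ≤-trans (≤-reflexive (count-none (λ c at → none (c , at)))) z≤n
    ... | yes (c₀ , at₀) with covered c₀
    ...   | a , b , cover = begin
      count (atRank j v)                    ≤⟨ count-mono _ _ (atRank⊆ at₀ cover) ⟩
      count (λ c → classOf c₀ c ∨ (classOf a c ∨ classOf b c)) ≤⟨ count-∨ (classOf c₀) _ ⟩
      count (classOf c₀) + count (λ c → classOf a c ∨ classOf b c)
        ≤⟨ +-monoʳ-≤ (count (classOf c₀)) (count-∨ (classOf a) (classOf b)) ⟩
      count (classOf c₀) + (count (classOf a) + count (classOf b))
        ≤⟨ +-mono-≤ (classes-in-part≤ c₀)
                    (+-mono-≤ (classes-in-part≤ a) (m≤n⇒m≤n+o 0 (classes-in-part≤ b))) ⟩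
      (k ∸ 1) + ((k ∸ 1) + ((k ∸ 1) + 0))  ∎
      where open ≤-Reasoning

    classes-near≤ : ∀ j → count (λ c → isRep classesD c ∧ nearᵇ j c) ≤ (k + k) * (3 * (k ∸ 1))
    classes-near≤ j = pigeonhole _ (rank D′) (rank D′ j ∸ k) (k + k) range (classes-at-rank≤ j)
      where
      range : ∀ c → T (isRep classesD c ∧ nearᵇ j c) →
        rank D′ j ∸ k ≤ rank D′ c × rank D′ c < rank D′ j ∸ k + (k + k)
      range c h with toWitness (proj₂ (to (T-∧ {isRep classesD c}) h))
      ... | j<c+k , c<j+k =
        m≤n+o⇒m∸n≤o (rank D′ j) k (≤-trans (<⇒≤ j<c+k) (≤-reflexive (+-comm (rank D′ c) k))) ,
        <-≤-trans c<j+k (begin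
          rank D′ j + k               ≤⟨ +-monoˡ-≤ k (m≤n+m∸n (rank D′ j) k) ⟩
          k + (rank D′ j ∸ k) + k     ≡⟨ cong (_+ k) (+-comm k (rank D′ j ∸ k)) ⟩
          rank D′ j ∸ k + k + k       ≡⟨ +-assoc (rank D′ j ∸ k) k k ⟩
          rank D′ j ∸ k + (k + k)     ∎)
        where open ≤-Reasoning

  stretch-bound : ∀ {Q} → classes D ⊑ Q → Q ⊑ classes D′ → stretchValue M Q ≤ 4 * k ^ 3
  stretch-bound {Q} D⊑Q Q⊑D′ = maxF-lub _ λ i → ⊔-lub (row i) (col i)
    where
    open Locality M k div′ Q⊑D′

    conflicting : ∀ (U : Subset n) j → (∀ z → T (U z) → Near D′ j z) →
      countF (λ c → isRep Q c ∧ conflict (part Q c) U) ≤ 4 * k ^ 3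
    conflicting U j U-near = begin
      countF (λ c → isRep Q c ∧ conflict (part Q c) U)
        ≡⟨ countF≡count (λ c → isRep Q c ∧ conflict (part Q c) U) ⟩
      count (λ c → isRep Q c ∧ conflict (part Q c) U)
        ≤⟨ count-mono _ _ to-class ⟩
      count (λ c → isRep classesD c ∧ nearᵇ j c) ≤⟨ classes-near≤ j ⟩
      (k + k) * (3 * (k ∸ 1))                   ≤⟨ cubic-bound k ⟩
      4 * k ^ 3                                 ∎
      where
      open ≤-Reasoning
      to-class : ∀ c → T (isRep Q c ∧ conflict (part Q c) U) → T (isRep classesD c ∧ nearᵇ j c)
      to-class c h = let rep , conf = to (T-∧ {isRep Q c}) h in
        from (T-∧ {isRep classesD c}) (isRep-⊑ D⊑Q rep , fromWitness (conflict⇒Near U-near conf))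

    same-class-near : ∀ {j z} → T (Q z ≡ᵇ Q j) → Near D′ j z
    same-class-near {j} {z} h = rank≡⇒Near k≥1 {D′}
      (rank-cong D′ div′ (sym (proj₁ (classes≡⇒Twin div′ (Q⊑D′ z j (≡ᵇ⇒≡ _ _ h))))))

    row : ∀ i → rowStretch M Q i ≤ 4 * k ^ 3
    row i = conflicting _ i λ z h → [ same-class-near , nonConst⇒Near symM ] (to T-∨ h)

    col : ∀ j → colStretch M Q j ≤ 4 * k ^ 3
    col j = conflicting _ j λ z h →
      [ same-class-near , Near-sym {D′} ∘ nonConst⇒Near symM ] (to T-∨ h)

relabel : ℕ → ℕ → ℕ → ℕ
relabel a b w = if w ≡ᵇ a then b else w

relabel-at : ∀ a b → relabel a b a ≡ b
relabel-at a b with a ≡ᵇ a | ≡⇒≡ᵇ a a refl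
... | true | _ = refl

relabel-elsewhere : ∀ {a} b {w} → w ≢ a → relabel a b w ≡ w
relabel-elsewhere {a} b {w} w≢a with w ≡ᵇ a in eq
... | true = ⊥-elim (w≢a (≡ᵇ⇒≡ w a (subst T (sym eq) tt)))
... | false = refl

relabel-≡⇔ : ∀ {a b} → a ≢ b → ∀ s t →
  relabel a b s ≡ relabel a b t ⇔ (s ≡ t ⊎ (s ≡ a × t ≡ b) ⊎ (s ≡ b × t ≡ a))
relabel-≡⇔ {a} {b} a≢b s t = mk⇔ forward backward
  where
  forward : relabel a b s ≡ relabel a b t → s ≡ t ⊎ (s ≡ a × t ≡ b) ⊎ (s ≡ b × t ≡ a)
  forward eq with s ≟ a | t ≟ a
  ... | yes refl | yes refl = inj₁ refl
  ... | yes refl | no t≢a =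
    inj₂ (inj₁ (refl , trans (sym (relabel-elsewhere b t≢a)) (trans (sym eq) (relabel-at a b))))
  ... | no s≢a | yes refl = inj₂ (inj₂ (trans (sym (relabel-elsewhere b s≢a)) (trans eq (relabel-at a b)) , refl))
  ... | no s≢a | no t≢a = inj₁ (trans (sym (relabel-elsewhere b s≢a)) (trans eq (relabel-elsewhere b t≢a)))
  backward : s ≡ t ⊎ (s ≡ a × t ≡ b) ⊎ (s ≡ b × t ≡ a) → relabel a b s ≡ relabel a b t
  backward (inj₁ refl) = refl
  backward (inj₂ (inj₁ (refl , refl))) = trans (relabel-at a b) (sym (relabel-elsewhere b (a≢b ∘ sym)))
  backward (inj₂ (inj₂ (refl , refl))) = trans (relabel-elsewhere b (a≢b ∘ sym)) (sym (relabel-at a b))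

merge-by-relabel : ∀ {n} (Q R : Labeling n) {u v} → Q u ≢ Q v →
  (∀ x → R x ≡ relabel (Q u) (Q v) (Q x)) → MergeStep Q R
merge-by-relabel Q R {u} {v} Qu≢Qv R≡ = u , v , Qu≢Qv , λ i j → mk⇔
  (to (relabel-≡⇔ Qu≢Qv (Q i) (Q j)) ∘ λ eq → trans (sym (R≡ i)) (trans eq (R≡ j)))
  (λ h → trans (R≡ i) (trans (from (relabel-≡⇔ Qu≢Qv (Q i) (Q j)) h) (sym (R≡ j))))

MergeStep-congˡ : ∀ {n} {Q Q′ R : Labeling n} → (∀ x → Q x ≡ Q′ x) → MergeStep Q′ R → MergeStep Q R
MergeStep-congˡ {n} {Q} {Q′} Q≗Q′ (a , b , a≁b , merged) =
  a , b , a≁b ∘ into , λ i j → mk⇔ (move outof ∘ to (merged i j)) (from (merged i j) ∘ move into)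
  where
  into : ∀ {u v} → Q u ≡ Q v → Q′ u ≡ Q′ v
  into {u} {v} eq = trans (sym (Q≗Q′ u)) (trans eq (Q≗Q′ v))
  outof : ∀ {u v} → Q′ u ≡ Q′ v → Q u ≡ Q v
  outof {u} {v} eq = trans (Q≗Q′ u) (trans eq (sym (Q≗Q′ v)))
  move : ∀ {L L′ : Labeling n} {i j} → (∀ {u v} → L u ≡ L v → L′ u ≡ L′ v) →
    L i ≡ L j ⊎ (L i ≡ L a × L j ≡ L b) ⊎ (L i ≡ L b × L j ≡ L a) →
    L′ i ≡ L′ j ⊎ (L′ i ≡ L′ a × L′ j ≡ L′ b) ⊎ (L′ i ≡ L′ b × L′ j ≡ L′ a)
  move f = Sum.map f (Sum.map (Product.map f f) (Product.map f f))

data Chain {n} (Good : Labeling n → Set) : Labeling n → Set where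
  done  : ∀ {Q} → Good Q → OnePart Q → Chain Good Q
  merge : ∀ {Q R} → Good Q → MergeStep Q R → Chain Good R → Chain Good Q

chain-cong : ∀ {n} {Good : Labeling n → Set} {Q R} → (∀ x → Q x ≡ R x) → Good Q →
  Chain Good R → Chain Good Q
chain-cong Q≗R good (done _ one) = done good λ i j → trans (Q≗R i) (trans (one i j) (sym (Q≗R j)))
chain-cong Q≗R good (merge _ step rest) = merge good (MergeStep-congˡ Q≗R step) rest

downward-induction : ∀ {ℓ} (P : ℕ → Set ℓ) {N} → P N → (∀ {m} → m < N → P (suc m) → P m) →
  ∀ {m} → m ≤ N → P m
downward-induction P {N} top step {m} m≤N = go (N ∸ m) (m∸n+n≡m m≤N)
  where
  go : ∀ d {m} → d + m ≡ N → P m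
  go zero refl = top
  go (suc d) {m} eq = step (subst (m <_) eq (m<n+m m z<s)) (go d {suc m} (trans (+-suc d m) eq))

module _ {n} {Good : Labeling n → Set} where

  chain-length : ∀ {Q} → Chain Good Q → ℕ
  chain-length (done _ _) = 0
  chain-length (merge _ _ rest) = suc (chain-length rest)

  chain-node : ∀ {Q} → Chain Good Q → ℕ → Labeling n
  chain-node {Q} (done _ _) _ = Q
  chain-node {Q} (merge _ _ _) zero = Q
  chain-node (merge _ _ rest) (suc t) = chain-node rest t

  chain-node-zero : ∀ {Q} (c : Chain Good Q) → chain-node c 0 ≡ Q
  chain-node-zero (done _ _) = refl
  chain-node-zero (merge _ _ _) = refl

  chain-node-last : ∀ {Q} (c : Chain Good Q) → OnePart (chain-node c (chain-length c))
  chain-node-last (done _ one) = one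
  chain-node-last (merge _ _ rest) = chain-node-last rest

  chain-node-step : ∀ {Q} (c : Chain Good Q) t → t < chain-length c → MergeStep (chain-node c t) (chain-node c (suc t))
  chain-node-step (merge _ merged rest) zero _ = subst (MergeStep _) (sym (chain-node-zero rest)) merged
  chain-node-step (merge _ _ rest) (suc t) t<len = chain-node-step rest t (s≤s⁻¹ t<len)

  chain-node-good : ∀ {Q} (c : Chain Good Q) t → t ≤ chain-length c → Good (chain-node c t)
  chain-node-good (done good _) _ _ = good
  chain-node-good (merge good _ _) zero _ = good
  chain-node-good (merge _ _ rest) (suc t) t≤len = chain-node-good rest t (s≤s⁻¹ t≤len)

  chain⇒sequence : ∀ {Q} → Chain Good Q → Singletons Q →
    Σ (PartitionSequence n) λ S → ∀ t → t ≤ len S → Good (P S t)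
  chain⇒sequence c singletons =
    record { len = chain-length c ; P = chain-node c ; start = subst Singletons (sym (chain-node-zero c)) singletons
           ; end = chain-node-last c ; step = chain-node-step c }
    , chain-node-good c

module Interpolation {n} {p q : Labeling n} (canon-p : Canonical p) (canon-q : Canonical q)
  (p⊑q : p ⊑ q) where

  open Canonical

  q≤p : ∀ x → q x ≤ p x
  q≤p x = let z , z≡px , pz≡px = label-attained canon-p x in begin
    q x    ≡⟨ p⊑q z x pz≡px ⟨
    q z    ≤⟨ label≤index canon-q z ⟩
    toℕ z  ≡⟨ z≡px ⟩
    p x    ∎
    where open ≤-Reasoning

  stage : ℕ → Labeling n
  stage m x = if p x <ᵇ m then q x else p x

  stage-below : ∀ {m x} → p x < m → stage m x ≡ q x
  stage-below {m} {x} px<m with p x <ᵇ m | <⇒<ᵇ px<m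
  ... | true | _ = refl

  stage-above : ∀ {m x} → ¬ p x < m → stage m x ≡ p x
  stage-above {m} {x} px≮m with p x <ᵇ m in eq
  ... | true = ⊥-elim (px≮m (<ᵇ⇒< (p x) m (subst T (sym eq) tt)))
  ... | false = refl

  stage-initial : ∀ x → stage 0 x ≡ p x
  stage-initial x = stage-above n≮0

  stage-final : ∀ x → stage n x ≡ q x
  stage-final x = stage-below (≤-<-trans (label≤index canon-p x) (toℕ<n x))

  p⊑stage : ∀ m → p ⊑ stage m
  p⊑stage m x y px≡py with p x <? m
  ... | yes px<m = begin
    stage m x ≡⟨ stage-below px<m ⟩
    q x       ≡⟨ p⊑q x y px≡py ⟩
    q y       ≡⟨ stage-below (subst (_< m) px≡py px<m) ⟨
    stage m y ∎
    where open ≡-Reasoning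
  ... | no px≮m = begin
    stage m x ≡⟨ stage-above px≮m ⟩
    p x       ≡⟨ px≡py ⟩
    p y       ≡⟨ stage-above (px≮m ∘ subst (_< m) (sym px≡py)) ⟨
    stage m y ∎
    where open ≡-Reasoning

  stage⊑q : ∀ m → stage m ⊑ q
  stage⊑q m x y eq with p x <? m | p y <? m
  ... | yes px<m | yes py<m = trans (sym (stage-below px<m)) (trans eq (stage-below py<m))
  ... | no px≮m | no py≮m = p⊑q x y (trans (sym (stage-above px≮m)) (trans eq (stage-above py≮m)))
  ... | yes px<m | no py≮m = ⊥-elim (py≮m (≤-<-trans (≤-reflexive (sym qx≡py)) (≤-<-trans (q≤p x) px<m)))
    where
    qx≡py : q x ≡ p y
    qx≡py = trans (sym (stage-below px<m)) (trans eq (stage-above py≮m))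
  ... | no px≮m | yes py<m = ⊥-elim (px≮m (≤-<-trans (≤-reflexive px≡qy) (≤-<-trans (q≤p y) py<m)))
    where
    px≡qy : p x ≡ q y
    px≡qy = trans (sym (stage-above px≮m)) (trans eq (stage-below py<m))

  stage-unchanged : ∀ {m} → (∀ z → p z ≡ m → q z ≡ m) → ∀ x → stage m x ≡ stage (suc m) x
  stage-unchanged {m} fixed x with <-cmp (p x) m
  ... | tri< px<m _ _ = trans (stage-below px<m) (sym (stage-below (m<n⇒m<1+n px<m)))
  ... | tri≈ _ px≡m _ = begin
    stage m x       ≡⟨ stage-above (<-irrefl px≡m) ⟩
    p x             ≡⟨ px≡m ⟩
    m               ≡⟨ fixed x px≡m ⟨
    q x             ≡⟨ stage-below (s≤s (≤-reflexive px≡m)) ⟨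
    stage (suc m) x ∎
    where open ≡-Reasoning
  ... | tri> _ _ m<px = trans (stage-above (<-asym m<px)) (sym (stage-above (<⇒≱ m<px ∘ s≤s⁻¹)))

  stage-suc : ∀ {m z} → p z ≡ m → ∀ x → stage (suc m) x ≡ relabel m (q z) (stage m x)
  stage-suc {m} {z} pz≡m x with <-cmp (p x) m
  ... | tri< px<m _ _ = begin
    stage (suc m) x             ≡⟨ stage-below (m<n⇒m<1+n px<m) ⟩
    q x                         ≡⟨ relabel-elsewhere (q z) (<⇒≢ (≤-<-trans (q≤p x) px<m)) ⟨
    relabel m (q z) (q x)       ≡⟨ cong (relabel m (q z)) (stage-below px<m) ⟨
    relabel m (q z) (stage m x) ∎
    where open ≡-Reasoning
  ... | tri≈ _ px≡m _ = begin
    stage (suc m) x             ≡⟨ stage-below (s≤s (≤-reflexive px≡m)) ⟩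
    q x                         ≡⟨ p⊑q x z (trans px≡m (sym pz≡m)) ⟩
    q z                         ≡⟨ relabel-at m (q z) ⟨
    relabel m (q z) m           ≡⟨ cong (relabel m (q z)) (trans (stage-above (<-irrefl px≡m)) px≡m) ⟨
    relabel m (q z) (stage m x) ∎
    where open ≡-Reasoning
  ... | tri> _ _ m<px = begin
    stage (suc m) x             ≡⟨ stage-above (<⇒≱ m<px ∘ s≤s⁻¹) ⟩
    p x                         ≡⟨ relabel-elsewhere (q z) (>⇒≢ m<px) ⟨
    relabel m (q z) (p x)       ≡⟨ cong (relabel m (q z)) (stage-above (<-asym m<px)) ⟨
    relabel m (q z) (stage m x) ∎
    where open ≡-Reasoning

  stage-merge : ∀ {m z} → p z ≡ m → q z ≢ m → MergeStep (stage m) (stage (suc m))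
  stage-merge {m} {z} pz≡m qz≢m with label-attained canon-q z
  ... | g , g≡qz , qg≡qz =
    merge-by-relabel (stage m) (stage (suc m)) {z} {g}
      (λ e → qz≢m (sym (trans (sym stage-z) (trans e stage-g))))
      (λ x → subst₂ (λ a b → stage (suc m) x ≡ relabel a b (stage m x)) (sym stage-z) (sym stage-g)
                    (stage-suc pz≡m x))
    where
    -- g, the least member of the q-part of z, is also the least member of its own p-part
    pg≡qz : p g ≡ q z
    pg≡qz = ≤-antisym (≤-trans (label≤index canon-p g) (≤-reflexive g≡qz))
                      (≤-trans (≤-reflexive (sym qg≡qz)) (q≤p g))
    stage-z : stage m z ≡ m
    stage-z = trans (stage-above (<-irrefl pz≡m)) pz≡m
    stage-g : stage m g ≡ q z
    stage-g = trans (stage-below (subst (_< m) (sym pg≡qz) (≤∧≢⇒< (≤-trans (q≤p z) (≤-reflexive pz≡m)) qz≢m)))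
                    qg≡qz

  stage-step : ∀ m → (∀ x → stage m x ≡ stage (suc m) x) ⊎ MergeStep (stage m) (stage (suc m))
  stage-step m with any? (λ z → (p z ≟ m) ×-dec ¬? (q z ≟ m))
  ... | yes (z , pz≡m , qz≢m) = inj₂ (stage-merge pz≡m qz≢m)
  ... | no none =
    inj₁ (stage-unchanged λ z pz≡m → decidable-stable (q z ≟ m) λ qz≢m → none (z , pz≡m , qz≢m))

  interpolate : ∀ {Good : Labeling n → Set} → (∀ {Q} → p ⊑ Q → Q ⊑ q → Good Q) →
    Chain Good q → Chain Good p
  interpolate {Good} good chain =
    chain-cong (sym ∘ stage-initial) (good (λ _ _ → id) p⊑q)
      (downward-induction (Chain Good ∘ stage) top extend z≤n)
    where
    good-stage : ∀ m → Good (stage m)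
    good-stage m = good (p⊑stage m) (stage⊑q m)
    top : Chain Good (stage n)
    top = chain-cong stage-final (good-stage n) chain
    extend : ∀ {m} → m < n → Chain Good (stage (suc m)) → Chain Good (stage m)
    extend {m} _ rest = Sum.[ (λ same → chain-cong same (good-stage m) rest)
                          , (λ merged → merge (good-stage m) merged rest) ]′ (stage-step m)

module _ {n} (M : Matrix n) (symM : Symmetric M) (k : ℕ) (k≥1 : 1 ≤ k) where

  open Twins M k

  Bounded : Labeling n → Set
  Bounded Q = stretchValue M Q ≤ 4 * k ^ 3

  last-chain : ∀ {D} → Diagonal M k D → OnePart D → Chain Bounded (classes D)
  last-chain {D} (div , not-wide) one =
    done (StretchBound.stretch-bound M symM k k≥1 div (proj₁ ∘ not-wide) div (covered-refl D)
           (λ _ _ → id) (λ _ _ → id))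
         (λ x y → Twin⇒classes≡ div (one x y , everything-near x y))
    where
    everything-near : ∀ x y → Agree D x y
    everything-near x _ c far = ⊥-elim (far (rank≡⇒Near k≥1 {D} (rank-cong D div (one x c))))

  extend-chain : ∀ {D D′} → Diagonal M k D → Diagonal M k D′ → MergeStep D D′ →
    Chain Bounded (classes D′) → Chain Bounded (classes D)
  extend-chain (div , not-wide) (div′ , _) merged =
    Interpolation.interpolate (classes-canonical div) (classes-canonical div′)
      (classes-coarsen k≥1 div div′ (MergeStep⇒⊑ merged))
      (StretchBound.stretch-bound M symM k k≥1 div (proj₁ ∘ not-wide) div′ (MergeStep⇒covered merged))

  stw≤-of-diagonal-sequence : HasDiagonalSequence M k → stw≤ M (4 * k ^ 3)
  stw≤-of-diagonal-sequence (S , diagonal) = chain⇒sequence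
    (downward-induction (Chain Bounded ∘ classes ∘ P S)
      (last-chain (diagonal (len S) ≤-refl) (end S))
      (λ {t} t<len → extend-chain (diagonal t (<⇒≤ t<len)) (diagonal (suc t) t<len) (step S t t<len))
      z≤n)
    λ x y eq → start S x y (proj₁ (classes≡⇒Twin (proj₁ (diagonal 0 z≤n)) eq))

theorem21 : (n : ℕ) (M : Matrix n) (k : ℕ) → Symmetric M →
    HasDiagonalSequence M k → stw≤ M (4 * k ^ 3)
theorem21 n M (suc k) symM diagonal = stw≤-of-diagonal-sequence M symM (suc k) (s≤s z≤n) diagonal
-- for k = 0 every part is vacuously 0-wide
theorem21 (suc n) M zero _ (_ , diagonal) = ⊥-elim (proj₁ (proj₂ (diagonal 0 z≤n) fzero) λ _ ())
theorem21 zero M zero _ _ =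
  record { len = 0 ; P = λ _ () ; start = λ () ; end = λ () ; step = λ _ () } , λ _ _ → z≤n
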